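{- Let $\ell\ne2$ and $p$ be distinct primes, $a$ an integer, and $\psi:\mathbb{Z}/p\mathbb{Z}\to\mathbb{C}^\times$ a nontrivial additive character. Then the Kloosterman sum $$K_2(\psi,a)=\sum_{\substack{x_1,x_2\in\mathbb{Z}/p\mathbb{Z}\\ x_1x_2\equiv a\pmod p}}\psi(x_1+x_2)$$ is not congruent to $0$ modulo $\ell$, i.e. $K_2(\psi,a)\notin\ell\,\mathbb{Z}[e^{2\pi i/p}]$. -}

module Defs where

open import Data.Nat as ℕ using (ℕ; NonZero)
open import Data.Nat.DivMod using (_mod_)
open import Data.Integer as ℤ using (ℤ)
open import Data.Integer.DivMod using (_%ℕ_)
open import Data.Fin as Fin using (Fin; toℕ)
open import Data.Fin.Properties using (_≟_)
open import Data.List using (List; allFin; foldr; map; concatMap)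
open import Data.Product using (_×_; _,_; ∃; ∃-syntax)
open import Relation.Nullary using (¬_; does)
open import Relation.Binary.PropositionalEquality using (_≡_; _≢_)
open import Data.Bool using (if_then_else_)

-- The ring ℤ[ζ_p], ζ_p = e^{2πi/p}, p prime, presented as the group ring
-- ℤ[ℤ/p] = ℤ^p (coefficient vector c ↦ Σ_k c_k ζ^k) modulo its kernel,
-- which is ℤ·(1,1,…,1) (since 1 + ζ + … + ζ^{p-1} = 0 is the only relation).
Cyc : ℕ → Set
Cyc p = Fin p → ℤ

_≈ᶜ_ : {p : ℕ} → Cyc p → Cyc p → Set
_≈ᶜ_ {p} c d = ∃[ m ] ((k : Fin p) → c k ≡ d k ℤ.+ m)

0ᶜ : {p : ℕ} → Cyc p
0ᶜ _ = ℤ.0ℤ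

_+ᶜ_ : {p : ℕ} → Cyc p → Cyc p → Cyc p
(c +ᶜ d) k = c k ℤ.+ d k

_·ᶜ_ : {p : ℕ} → ℤ → Cyc p → Cyc p
(n ·ᶜ c) k = n ℤ.* c k

ζ^ : {p : ℕ} → Fin p → Cyc p
ζ^ j k = if does (j ≟ k) then ℤ.1ℤ else ℤ.0ℤ

_∣ᶜ_ : {p : ℕ} → ℕ → Cyc p → Set
_∣ᶜ_ {p} ℓ c = ∃[ d ] (c ≈ᶜ ((ℤ.+ ℓ) ·ᶜ d))

_⊕_ : {p : ℕ} .{{_ : NonZero p}} → Fin p → Fin p → Fin p
_⊕_ {p} x y = (toℕ x ℕ.+ toℕ y) mod p

_⊗_ : {p : ℕ} .{{_ : NonZero p}} → Fin p → Fin p → Fin p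
_⊗_ {p} x y = (toℕ x ℕ.* toℕ y) mod p

[_]ₚ : {p : ℕ} .{{_ : NonZero p}} → ℤ → Fin p
[_]ₚ {p} a = (a %ℕ p) mod p

-- An additive character ψ : ℤ/p → ℂ^× takes values in μ_p = {ζ^j}, so it is
-- ψ(x) = ζ^{e(x)} for an additive map e : ℤ/p → ℤ/p.
IsAddHom : (p : ℕ) .{{_ : NonZero p}} → (Fin p → Fin p) → Set
IsAddHom p e = (x y : Fin p) → e (x ⊕ y) ≡ e x ⊕ e y

Nontrivial : (p : ℕ) → (Fin p → Fin p) → Set
Nontrivial p e = ∃[ x ] (toℕ (e x) ≢ 0)

sumᶜ : {p : ℕ} → List (Cyc p) → Cyc p
sumᶜ = foldr _+ᶜ_ 0ᶜ

pairs : (p : ℕ) → List (Fin p × Fin p)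
pairs p = concatMap (λ x → map (λ y → (x , y)) (allFin p)) (allFin p)

K₂ : (p : ℕ) .{{_ : NonZero p}} → (Fin p → Fin p) → ℤ → Cyc p
K₂ p e a = sumᶜ (map term (pairs p))
  where
  term : Fin p × Fin p → Cyc p
  term (x₁ , x₂) = if does ((x₁ ⊗ x₂) ≟ [ a ]ₚ) then ζ^ (e (x₁ ⊕ x₂)) else 0ᶜ

{-# OPTIONS --safe #-}
module Submission where

-- Write ψ = ζ^{e(·)}. Then K₂(ψ, a) = Σ_k N_k ζ^k, where N_k counts the pairs (x, y)
-- with x y = a and e(x + y) = k. A nontrivial additive e is x ↦ λ x with p ∤ λ, hence
-- injective, so all pairs counted by N_k have the same sum and product: x is a root of
-- a fixed quadratic and N_k ≤ 2. Since Σ_k ζ^k = 0 is the only relation among the ζ^k,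
-- ℓ ∣ K₂ means that all N_k are congruent mod ℓ, and as N_k ≤ 2 < ℓ they are all equal, to c
-- say. But Σ_k N_k = p c is the number of solutions of x y = a, which is
-- p - 1 + p [a ≡ 0], not a multiple of p.

open import Defs
open import Data.Nat as ℕ using (ℕ; NonZero; zero; suc; _≤_; _<_; z≤n; s≤s)
import Data.Nat.Properties as ℕP
import Data.Nat.Divisibility as ℕD
open import Data.Nat.DivMod using (_mod_; _%_; _/_; m≡m%n+[m/n]*n; m%n<n)
open import Data.Nat.Primality using (Prime; euclidsLemma; prime⇒nonTrivial)
open import Data.Nat.Coprimality using (coprime-Bézout; prime⇒coprime)
open import Data.Nat.GCD using (module Bézout)
open import Data.Nat.ListAction using (sum)
open import Data.Nat.ListAction.Properties using (sum-++)
open import Data.Integer as ℤ using (ℤ; +_; _+_; _*_; _-_; -_; 0ℤ; 1ℤ; ∣_∣; _⊖_)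
import Data.Integer.Properties as ℤP
open import Data.Integer.DivMod using (_%ℕ_; _/ℕ_; a≡a%ℕn+[a/ℕn]*n)
open import Data.Integer.Divisibility.Signed
  using (_∣_; divides; ∣m∣n⇒∣m+n; ∣m∣n⇒∣m-n; ∣m⇒∣-m; ∣n⇒∣m*n; ∣⇒∣ᵤ; ∣ᵤ⇒∣)
open import Data.Integer.Tactic.RingSolver using (solve-∀)
open import Data.Fin using (Fin; zero; suc; toℕ)
open import Data.Fin.Properties using (_≟_; toℕ-fromℕ<; toℕ-injective; toℕ<n)
open import Data.List using (List; []; _∷_; _++_; map; concatMap; tabulate; allFin)
open import Data.List.Properties using (map-++; map-∘; map-cong; map-tabulate)
open import Algebra.Properties.Semiring.Sum ℕP.+-*-semiring
  using (sum-syntax; sum-cong-≗; sum-replicate-zero; ∑-comm; ∑-distrib-+)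
open import Data.Bool using (true; false; if_then_else_)
open import Data.Product using (_×_; _,_; proj₁; proj₂; ∃-syntax)
open import Data.Sum as Sum using (_⊎_; [_,_]′)
open import Function using (_∘_; id)
open import Level using (0ℓ)
open import Relation.Nullary using (¬_; Dec; yes; no; does; contradiction)
open import Relation.Nullary.Decidable using (_×-dec_; _⊎-dec_)
open import Relation.Binary.Bundles using (Setoid)
import Relation.Binary.Reasoning.Setoid as SetoidReasoning
open import Relation.Binary.PropositionalEquality
  using (_≡_; _≢_; refl; sym; trans; cong; cong₂; subst; subst₂; module ≡-Reasoning)

𝟙 : ∀ {a} {P : Set a} → Dec P → ℕ
𝟙 P? = if does P? then 1 else 0

module _ {a} {P : Set a} where

  𝟙-yes : P → (P? : Dec P) → 𝟙 P? ≡ 1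
  𝟙-yes _ (yes _) = refl
  𝟙-yes p (no ¬p) = contradiction p ¬p

  𝟙≤1 : (P? : Dec P) → 𝟙 P? ≤ 1
  𝟙≤1 (yes _) = s≤s z≤n
  𝟙≤1 (no _)  = z≤n

  𝟙≢0⇒ : (P? : Dec P) → 𝟙 P? ≢ 0 → P
  𝟙≢0⇒ (yes p) _   = p
  𝟙≢0⇒ (no _)  ≢0 = contradiction refl ≢0

  ≤1⇒≤𝟙 : ∀ {m} → m ≤ 1 → (m ≢ 0 → P) → (P? : Dec P) → m ≤ 𝟙 P?
  ≤1⇒≤𝟙 z≤n       _       _  = z≤n
  ≤1⇒≤𝟙 (s≤s z≤n) support P? = ℕP.≤-reflexive (sym (𝟙-yes (support λ ()) P?))

  module _ {b} {Q : Set b} where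

    𝟙-cong : (P → Q) → (Q → P) → (P? : Dec P) (Q? : Dec Q) → 𝟙 P? ≡ 𝟙 Q?
    𝟙-cong _   _   (yes _) (yes _) = refl
    𝟙-cong P⇒Q _   (yes p) (no ¬q) = contradiction (P⇒Q p) ¬q
    𝟙-cong _   Q⇒P (no ¬p) (yes q) = contradiction (Q⇒P q) ¬p
    𝟙-cong _   _   (no _)  (no _)  = refl

    𝟙-⊎ : (P? : Dec P) (Q? : Dec Q) → 𝟙 (P? ⊎-dec Q?) ≤ 𝟙 P? ℕ.+ 𝟙 Q?
    𝟙-⊎ (yes _) _ = s≤s z≤n
    𝟙-⊎ (no _)  _ = ℕP.≤-refl

∑-const : ∀ n c → ∑[ i < n ] c ≡ n ℕ.* c
∑-const zero    c = refl
∑-const (suc n) c = cong (c ℕ.+_) (∑-const n c)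

∑-mono-≤ : ∀ {n} {f g : Fin n → ℕ} → (∀ i → f i ≤ g i) → ∑[ i < n ] f i ≤ ∑[ i < n ] g i
∑-mono-≤ {zero}  f≤g = z≤n
∑-mono-≤ {suc n} f≤g = ℕP.+-mono-≤ (f≤g zero) (∑-mono-≤ (f≤g ∘ suc))

∑-𝟙-≟ : ∀ {n} (i : Fin n) → ∑[ j < n ] 𝟙 (i ≟ j) ≡ 1
∑-𝟙-≟ {suc n} zero    = cong suc (sum-replicate-zero n)
∑-𝟙-≟ {suc n} (suc i) = ∑-𝟙-≟ i

∑-𝟙-× : ∀ {n a} {P : Set a} (P? : Dec P) (i : Fin n) → ∑[ j < n ] 𝟙 (P? ×-dec i ≟ j) ≡ 𝟙 P?
∑-𝟙-× {n} (yes _) i = ∑-𝟙-≟ i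
∑-𝟙-× {n} (no _)  i = sum-replicate-zero n

∑≢0⇒∃ : ∀ {n} (f : Fin n → ℕ) → ∑[ i < n ] f i ≢ 0 → ∃[ i ] f i ≢ 0
∑≢0⇒∃ {zero}  f ∑≢0 = contradiction refl ∑≢0
∑≢0⇒∃ {suc n} f ∑≢0 with f zero ℕ.≟ 0
... | no f₀≢0  = zero , f₀≢0
... | yes f₀≡0 = let i , fᵢ≢0 = ∑≢0⇒∃ (f ∘ suc) (∑≢0 ∘ cong₂ ℕ._+_ f₀≡0) in suc i , fᵢ≢0

module _ {n} (f : Fin n → ℕ) (f≤1 : ∀ i → f i ≤ 1) where
  open ℕP.≤-Reasoning

  ∑-≤1 : (∀ i j → f i ≢ 0 → f j ≢ 0 → i ≡ j) → ∑[ i < n ] f i ≤ 1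
  ∑-≤1 unique with ∑[ i < n ] f i ℕ.≟ 0
  ... | yes ∑≡0 = ℕP.≤-trans (ℕP.≤-reflexive ∑≡0) z≤n
  ... | no ∑≢0  = let i , fᵢ≢0 = ∑≢0⇒∃ f ∑≢0 in begin
    ∑[ j < n ] f j         ≤⟨ ∑-mono-≤ (λ j → ≤1⇒≤𝟙 (f≤1 j) (unique i j fᵢ≢0) (i ≟ j)) ⟩
    ∑[ j < n ] 𝟙 (i ≟ j)  ≡⟨ ∑-𝟙-≟ i ⟩
    1                      ∎

  ∑-≤2 : (∀ i → f i ≢ 0 → ∃[ i′ ] ∀ j → f j ≢ 0 → i ≡ j ⊎ i′ ≡ j) → ∑[ i < n ] f i ≤ 2
  ∑-≤2 pair with ∑[ i < n ] f i ℕ.≟ 0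
  ... | yes ∑≡0 = ℕP.≤-trans (ℕP.≤-reflexive ∑≡0) z≤n
  ... | no ∑≢0  = let i , fᵢ≢0 = ∑≢0⇒∃ f ∑≢0 ; i′ , ⊆pair = pair i fᵢ≢0 in begin
    ∑[ j < n ] f j                             ≤⟨ ∑-mono-≤ (λ j → ℕP.≤-trans
                                                    (≤1⇒≤𝟙 (f≤1 j) (⊆pair j) (i ≟ j ⊎-dec i′ ≟ j))
                                                    (𝟙-⊎ (i ≟ j) (i′ ≟ j))) ⟩
    ∑[ j < n ] (𝟙 (i ≟ j) ℕ.+ 𝟙 (i′ ≟ j))    ≡⟨ ∑-distrib-+ (λ j → 𝟙 (i ≟ j)) (λ j → 𝟙 (i′ ≟ j)) ⟩
    ∑[ j < n ] 𝟙 (i ≟ j) ℕ.+ ∑[ j < n ] 𝟙 (i′ ≟ j) ≡⟨ cong₂ ℕ._+_ (∑-𝟙-≟ i) (∑-𝟙-≟ i′) ⟩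
    2                                          ∎

-- A record rather than a function into Set, so that x and y can be recovered by unification.
infix 4 _≡_[mod_]
record _≡_[mod_] (x y : ℤ) (n : ℕ) : Set where
  constructor mod-by
  field divides-difference : + n ∣ x - y
open _≡_[mod_]

module _ {n : ℕ} where

  mod-reflexive : ∀ {x y} → x ≡ y → x ≡ y [mod n ]
  mod-reflexive {x} refl = mod-by (divides 0ℤ (ℤP.+-inverseʳ x))

  mod-sym : ∀ {x y} → x ≡ y [mod n ] → y ≡ x [mod n ]
  mod-sym {x} {y} (mod-by n∣x-y) = mod-by (subst (+ n ∣_) (negate-minus x y) (∣m⇒∣-m n∣x-y))
    where
    negate-minus : ∀ x y → - (x - y) ≡ y - x
    negate-minus = solve-∀

  mod-trans : ∀ {x y z} → x ≡ y [mod n ] → y ≡ z [mod n ] → x ≡ z [mod n ]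
  mod-trans {x} {y} {z} (mod-by n∣x-y) (mod-by n∣y-z) =
    mod-by (subst (+ n ∣_) (ℤP.+-minus-telescope x y z) (∣m∣n⇒∣m+n n∣x-y n∣y-z))

  +-cong-mod : ∀ {x y u v} → x ≡ y [mod n ] → u ≡ v [mod n ] → x + u ≡ y + v [mod n ]
  +-cong-mod {x} {y} {u} {v} (mod-by n∣x-y) (mod-by n∣u-v) =
    mod-by (subst (+ n ∣_) (identity x y u v) (∣m∣n⇒∣m+n n∣x-y n∣u-v))
    where
    identity : ∀ x y u v → (x - y) + (u - v) ≡ (x + u) - (y + v)
    identity = solve-∀

  *-cong-mod : ∀ {x y u v} → x ≡ y [mod n ] → u ≡ v [mod n ] → x * u ≡ y * v [mod n ]
  *-cong-mod {x} {y} {u} {v} (mod-by n∣x-y) (mod-by n∣u-v) =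
    mod-by (subst (+ n ∣_) (identity x y u v) (∣m∣n⇒∣m+n (∣n⇒∣m*n u n∣x-y) (∣n⇒∣m*n y n∣u-v)))
    where
    identity : ∀ x y u v → u * (x - y) + y * (u - v) ≡ x * u - y * v
    identity = solve-∀

  *-congˡ-mod : ∀ x {u v} → u ≡ v [mod n ] → x * u ≡ x * v [mod n ]
  *-congˡ-mod x = *-cong-mod (mod-reflexive {x = x} refl)

  *-congʳ-mod : ∀ u {x y} → x ≡ y [mod n ] → x * u ≡ y * u [mod n ]
  *-congʳ-mod u x≡y = *-cong-mod x≡y (mod-reflexive {x = u} refl)

  +-cancelˡ-mod : ∀ {x y z} → x + y ≡ x + z [mod n ] → y ≡ z [mod n ]
  +-cancelˡ-mod {x} {y} {z} (mod-by n∣x+y-x+z) = mod-by (subst (+ n ∣_) (identity x y z) n∣x+y-x+z)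
    where
    identity : ∀ x y z → (x + y) - (x + z) ≡ y - z
    identity = solve-∀

  ∣⇒≡0-mod : ∀ {x} → + n ∣ x → x ≡ 0ℤ [mod n ]
  ∣⇒≡0-mod {x} n∣x = mod-by (subst (+ n ∣_) (sym (ℤP.+-identityʳ x)) n∣x)

  +*⇒mod : ∀ {x y} q → x ≡ y + q * + n → x ≡ y [mod n ]
  +*⇒mod {x} {y} q refl = mod-by (divides q (identity y q (+ n)))
    where
    identity : ∀ y q n → (y + q * n) - y ≡ q * n
    identity = solve-∀

mod-setoid : ℕ → Setoid 0ℓ 0ℓ
mod-setoid n = record
  { Carrier       = ℤ
  ; _≈_           = _≡_[mod n ]
  ; isEquivalence = record { refl = mod-reflexive refl ; sym = mod-sym ; trans = mod-trans }
  }

pos-+-* : ∀ a b c → + (a ℕ.+ b ℕ.* c) ≡ + a + + b * + c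
pos-+-* a b c = trans (ℤP.pos-+ a (b ℕ.* c)) (cong (λ t → + a + t) (ℤP.pos-* b c))

∣∧<⇒≡0 : ∀ {d m} → d ℕD.∣ m → m < d → m ≡ 0
∣∧<⇒≡0 {m = zero}  _   _   = refl
∣∧<⇒≡0 {m = suc _} d∣m m<d = contradiction d∣m (ℕD.>⇒∤ m<d)

mod-injective-< : ∀ {n u v} → + u ≡ + v [mod n ] → u < n → v < n → u ≡ v
mod-injective-< {n} {u} {v} (mod-by n∣u-v) u<n v<n =
  ℤP.+-injective (ℤP.i-j≡0⇒i≡j (+ u) (+ v) (ℤP.∣i∣≡0⇒i≡0 (∣∧<⇒≡0 (∣⇒∣ᵤ n∣u-v) ∣u-v∣<n)))
  where
  open ℕP.≤-Reasoning
  ∣u-v∣<n : ∣ + u - + v ∣ < n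
  ∣u-v∣<n = begin-strict
    ∣ + u - + v ∣  ≡⟨ cong ∣_∣ (ℤP.m-n≡m⊖n u v) ⟩
    ∣ u ⊖ v ∣      ≤⟨ ℤP.∣m⊝n∣≤m⊔n u v ⟩
    u ℕ.⊔ v        <⟨ ℕP.⊔-lub u<n v<n ⟩
    n              ∎

euclidsLemmaℤ : ∀ {p} x y → Prime p → + p ∣ x * y → (+ p ∣ x) ⊎ (+ p ∣ y)
euclidsLemmaℤ x y p-prime p∣xy = Sum.map ∣ᵤ⇒∣ ∣ᵤ⇒∣
  (euclidsLemma ∣ x ∣ ∣ y ∣ p-prime (subst (_ ℕD.∣_) (ℤP.abs-* x y) (∣⇒∣ᵤ p∣xy)))

mod-inverse : ∀ {p m} → Prime p → 0 < m → m < p → ∃[ u ] u * + m ≡ 1ℤ [mod p ]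
mod-inverse {p} {m} p-prime 0<m m<p
  with coprime-Bézout (prime⇒coprime p-prime {{ℕ.>-nonZero 0<m}} m<p)
... | Bézout.-+ x y 1+xp≡ym = + y , +*⇒mod (+ x) (begin
  + y * + m          ≡⟨ ℤP.pos-* y m ⟨
  + (y ℕ.* m)        ≡⟨ cong +_ 1+xp≡ym ⟨
  + (1 ℕ.+ x ℕ.* p)  ≡⟨ pos-+-* 1 x p ⟩
  1ℤ + + x * + p     ∎)
  where open ≡-Reasoning
... | Bézout.+- x y 1+ym≡xp = - + y , +*⇒mod (- + x) (begin
  - + y * + m              ≡⟨ identity (+ y) (+ m) ⟩
  1ℤ - (1ℤ + + y * + m)    ≡⟨ cong (λ t → 1ℤ - t) (pos-+-* 1 y m) ⟨
  1ℤ - + (1 ℕ.+ y ℕ.* m)   ≡⟨ cong (λ t → 1ℤ - + t) 1+ym≡xp ⟩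
  1ℤ - + (x ℕ.* p)         ≡⟨ cong (λ t → 1ℤ - t) (ℤP.pos-* x p) ⟩
  1ℤ - + x * + p           ≡⟨ cong (λ t → 1ℤ + t) (ℤP.neg-distribˡ-* (+ x) (+ p)) ⟩
  1ℤ + - + x * + p         ∎)
  where
  open ≡-Reasoning
  identity : ∀ y m → - y * m ≡ 1ℤ - (1ℤ + y * m)
  identity = solve-∀

toℤ : ∀ {p} → Fin p → ℤ
toℤ x = + toℕ x

module ≈-mod-Reasoning (n : ℕ) = SetoidReasoning (mod-setoid n)

module _ {p : ℕ} .{{_ : NonZero p}} where

  toℤ-mod : ∀ m → toℤ (m mod p) ≡ + m [mod p ]
  toℤ-mod m = mod-sym (+*⇒mod (+ (m / p)) (begin
    + m                            ≡⟨ cong +_ (m≡m%n+[m/n]*n m p) ⟩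
    + (m % p ℕ.+ m / p ℕ.* p)      ≡⟨ pos-+-* (m % p) (m / p) p ⟩
    + (m % p) + + (m / p) * + p    ≡⟨ cong (λ r → + r + + (m / p) * + p) (toℕ-fromℕ< (m%n<n m p)) ⟨
    toℤ (m mod p) + + (m / p) * + p ∎))
    where open ≡-Reasoning

  toℤ-⊕ : ∀ x y → toℤ (x ⊕ y) ≡ toℤ x + toℤ y [mod p ]
  toℤ-⊕ x y = toℤ-mod (toℕ x ℕ.+ toℕ y)

  toℤ-⊗ : ∀ x y → toℤ (x ⊗ y) ≡ toℤ x * toℤ y [mod p ]
  toℤ-⊗ x y = begin
    toℤ (x ⊗ y)             ≈⟨ toℤ-mod (toℕ x ℕ.* toℕ y) ⟩
    + (toℕ x ℕ.* toℕ y)     ≡⟨ ℤP.pos-* (toℕ x) (toℕ y) ⟩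
    toℤ x * toℤ y           ∎
    where open ≈-mod-Reasoning p

  toℤ-[]ₚ : ∀ z → toℤ [ z ]ₚ ≡ z [mod p ]
  toℤ-[]ₚ z = mod-trans (toℤ-mod (z %ℕ p)) (mod-sym (+*⇒mod (z /ℕ p) (a≡a%ℕn+[a/ℕn]*n z p)))

  toℤ-injective-mod : ∀ {x y : Fin p} → toℤ x ≡ toℤ y [mod p ] → x ≡ y
  toℤ-injective-mod {x} {y} x≡y = toℕ-injective (mod-injective-< x≡y (toℕ<n x) (toℕ<n y))

  toℕ-mod : ∀ (x : Fin p) → toℕ x mod p ≡ x
  toℕ-mod x = toℤ-injective-mod (toℤ-mod (toℕ x))

  mod-⊕ : ∀ m m′ → (m mod p) ⊕ (m′ mod p) ≡ (m ℕ.+ m′) mod p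
  mod-⊕ m m′ = toℤ-injective-mod (begin
    toℤ ((m mod p) ⊕ (m′ mod p))      ≈⟨ toℤ-⊕ (m mod p) (m′ mod p) ⟩
    toℤ (m mod p) + toℤ (m′ mod p)    ≈⟨ +-cong-mod (toℤ-mod m) (toℤ-mod m′) ⟩
    + (m ℕ.+ m′)                      ≈⟨ toℤ-mod (m ℕ.+ m′) ⟨
    toℤ ((m ℕ.+ m′) mod p)            ∎)
    where open ≈-mod-Reasoning p

  ⊕≡⇒mod : ∀ (x y x′ y′ : Fin p) → x ⊕ y ≡ x′ ⊕ y′ → toℤ x + toℤ y ≡ toℤ x′ + toℤ y′ [mod p ]
  ⊕≡⇒mod x y x′ y′ x⊕y≡x′⊕y′ = begin
    toℤ x + toℤ y     ≈⟨ toℤ-⊕ x y ⟨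
    toℤ (x ⊕ y)       ≡⟨ cong toℤ x⊕y≡x′⊕y′ ⟩
    toℤ (x′ ⊕ y′)     ≈⟨ toℤ-⊕ x′ y′ ⟩
    toℤ x′ + toℤ y′   ∎
    where open ≈-mod-Reasoning p

  ⊗≡⇒mod : ∀ (x y x′ y′ : Fin p) → x ⊗ y ≡ x′ ⊗ y′ → toℤ x * toℤ y ≡ toℤ x′ * toℤ y′ [mod p ]
  ⊗≡⇒mod x y x′ y′ x⊗y≡x′⊗y′ = begin
    toℤ x * toℤ y     ≈⟨ toℤ-⊗ x y ⟨
    toℤ (x ⊗ y)       ≡⟨ cong toℤ x⊗y≡x′⊗y′ ⟩
    toℤ (x′ ⊗ y′)     ≈⟨ toℤ-⊗ x′ y′ ⟩
    toℤ x′ * toℤ y′   ∎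
    where open ≈-mod-Reasoning p

  ⊕-cancelˡ : ∀ x {y y′ : Fin p} → x ⊕ y ≡ x ⊕ y′ → y ≡ y′
  ⊕-cancelˡ x {y} {y′} = toℤ-injective-mod ∘ +-cancelˡ-mod {x = toℤ x} ∘ ⊕≡⇒mod x y x y′

  toℤ≢0-mod : ∀ {x : Fin p} → toℕ x ≢ 0 → ¬ (toℤ x ≡ 0ℤ [mod p ])
  toℤ≢0-mod {x} x≢0 x≡0 = x≢0 (mod-injective-< x≡0 (toℕ<n x) (ℕ.>-nonZero⁻¹ p))

module _ {p : ℕ} .{{_ : NonZero p}} (p-prime : Prime p) where

  ⊗-cancelˡ : ∀ {x y y′ : Fin p} → toℕ x ≢ 0 → x ⊗ y ≡ x ⊗ y′ → y ≡ y′
  ⊗-cancelˡ {x} {y} {y′} x≢0 x⊗y≡x⊗y′ =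
    [ (λ p∣x → contradiction (∣⇒≡0-mod p∣x) (toℤ≢0-mod x≢0)) , toℤ-injective-mod ∘ mod-by ]′
      (euclidsLemmaℤ (toℤ x) (toℤ y - toℤ y′) p-prime p∣x[y-y′])
    where
    identity : ∀ x y y′ → x * y - x * y′ ≡ x * (y - y′)
    identity = solve-∀
    p∣x[y-y′] : + p ∣ toℤ x * (toℤ y - toℤ y′)
    p∣x[y-y′] = subst (+ p ∣_) (identity (toℤ x) (toℤ y) (toℤ y′))
                      (divides-difference (⊗≡⇒mod x y x y′ x⊗y≡x⊗y′))

  ⊗-solvable : ∀ {x : Fin p} → toℕ x ≢ 0 → ∀ a → ∃[ y ] x ⊗ y ≡ a
  ⊗-solvable {x} x≢0 a = [ u * toℤ a ]ₚ , toℤ-injective-mod (begin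
      toℤ (x ⊗ [ u * toℤ a ]ₚ)      ≈⟨ toℤ-⊗ x _ ⟩
      toℤ x * toℤ [ u * toℤ a ]ₚ    ≈⟨ *-congˡ-mod (toℤ x) (toℤ-[]ₚ (u * toℤ a)) ⟩
      toℤ x * (u * toℤ a)           ≡⟨ identity (toℤ x) u (toℤ a) ⟩
      (u * toℤ x) * toℤ a           ≈⟨ *-congʳ-mod (toℤ a) u*x≡1 ⟩
      1ℤ * toℤ a                    ≡⟨ ℤP.*-identityˡ (toℤ a) ⟩
      toℤ a                         ∎)
    where
    open ≈-mod-Reasoning p
    inverse = mod-inverse p-prime (ℕP.n≢0⇒n>0 x≢0) (toℕ<n x)
    u = proj₁ inverse
    u*x≡1 = proj₂ inverse
    identity : ∀ x u a → x * (u * a) ≡ (u * x) * a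
    identity = solve-∀

  vieta : ∀ {x y x′ y′ : Fin p} → x ⊕ y ≡ x′ ⊕ y′ → x ⊗ y ≡ x′ ⊗ y′ → x′ ≡ x ⊎ x′ ≡ y
  vieta {x} {y} {x′} {y′} x⊕y≡x′⊕y′ x⊗y≡x′⊗y′ =
    Sum.map (toℤ-injective-mod ∘ mod-by) (toℤ-injective-mod ∘ mod-by)
      (euclidsLemmaℤ (X′ - X) (X′ - Y) p-prime p∣[x′-x][x′-y])
    where
    X = toℤ x ; Y = toℤ y ; X′ = toℤ x′ ; Y′ = toℤ y′
    identity : ∀ x y x′ y′ → (x * y - x′ * y′) - x′ * ((x + y) - (x′ + y′)) ≡ (x′ - x) * (x′ - y)
    identity = solve-∀
    p∣[x′-x][x′-y] : + p ∣ (X′ - X) * (X′ - Y)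
    p∣[x′-x][x′-y] = subst (+ p ∣_) (identity X Y X′ Y′)
      (∣m∣n⇒∣m-n (divides-difference (⊗≡⇒mod x y x′ y′ x⊗y≡x′⊗y′))
                 (∣n⇒∣m*n X′ (divides-difference (⊕≡⇒mod x y x′ y′ x⊕y≡x′⊕y′))))

module _ {p : ℕ} .{{_ : NonZero p}} {e : Fin p → Fin p} (e-hom : IsAddHom p e) where

  private
    λₑ : ℤ
    λₑ = toℤ (e (1 mod p))

  e-zero : toℤ (e (0 mod p)) ≡ 0ℤ [mod p ]
  e-zero = mod-sym (+-cancelˡ-mod {x = e₀} (begin
    e₀ + 0ℤ                       ≡⟨ ℤP.+-identityʳ e₀ ⟩
    e₀                            ≡⟨ cong (toℤ ∘ e) (mod-⊕ 0 0) ⟨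
    toℤ (e ((0 mod p) ⊕ (0 mod p)))  ≡⟨ cong toℤ (e-hom (0 mod p) (0 mod p)) ⟩
    toℤ (e (0 mod p) ⊕ e (0 mod p))  ≈⟨ toℤ-⊕ (e (0 mod p)) (e (0 mod p)) ⟩
    e₀ + e₀                       ∎))
    where
    open ≈-mod-Reasoning p
    e₀ = toℤ (e (0 mod p))

  e-mod-linear : ∀ m → toℤ (e (m mod p)) ≡ + m * λₑ [mod p ]
  e-mod-linear zero    = e-zero
  e-mod-linear (suc m) = begin
    toℤ (e (suc m mod p))              ≡⟨ cong (toℤ ∘ e) (mod-⊕ 1 m) ⟨
    toℤ (e ((1 mod p) ⊕ (m mod p)))    ≡⟨ cong toℤ (e-hom (1 mod p) (m mod p)) ⟩
    toℤ (e (1 mod p) ⊕ e (m mod p))    ≈⟨ toℤ-⊕ (e (1 mod p)) (e (m mod p)) ⟩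
    λₑ + toℤ (e (m mod p))             ≈⟨ +-cong-mod (mod-reflexive {x = λₑ} refl) (e-mod-linear m) ⟩
    λₑ + + m * λₑ                      ≡⟨ identity λₑ (+ m) ⟩
    + suc m * λₑ                       ∎
    where
    open ≈-mod-Reasoning p
    identity : ∀ l m → l + m * l ≡ (1ℤ + m) * l
    identity = solve-∀

  e-linear : ∀ x → toℤ (e x) ≡ toℤ x * λₑ [mod p ]
  e-linear x = subst (λ x′ → toℤ (e x′) ≡ toℤ x * λₑ [mod p ]) (toℕ-mod x) (e-mod-linear (toℕ x))

  e-injective : Prime p → Nontrivial p e → ∀ {x y} → e x ≡ e y → x ≡ y
  e-injective p-prime (x₀ , ex₀≢0) {x} {y} ex≡ey =
    [ toℤ-injective-mod ∘ mod-by , (λ p∣λ → contradiction p∣λ p∤λ) ]′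
      (euclidsLemmaℤ (toℤ x - toℤ y) λₑ p-prime p∣[x-y]λ)
    where
    open ≈-mod-Reasoning p
    p∤λ : ¬ (+ p ∣ λₑ)
    p∤λ p∣λ = toℤ≢0-mod ex₀≢0 (begin
      toℤ (e x₀)      ≈⟨ e-linear x₀ ⟩
      toℤ x₀ * λₑ     ≈⟨ *-congˡ-mod (toℤ x₀) (∣⇒≡0-mod p∣λ) ⟩
      toℤ x₀ * 0ℤ     ≡⟨ ℤP.*-zeroʳ (toℤ x₀) ⟩
      0ℤ              ∎)
    identity : ∀ x y l → x * l - y * l ≡ (x - y) * l
    identity = solve-∀
    p∣[x-y]λ : + p ∣ (toℤ x - toℤ y) * λₑ
    p∣[x-y]λ = subst (+ p ∣_) (identity (toℤ x) (toℤ y) λₑ) (divides-difference (begin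
      toℤ x * λₑ      ≈⟨ e-linear x ⟨
      toℤ (e x)       ≡⟨ cong toℤ ex≡ey ⟩
      toℤ (e y)       ≈⟨ e-linear y ⟩
      toℤ y * λₑ      ∎))

∣ᶜ⇒≡-mod : ∀ {ℓ p} {c : Cyc p} → ℓ ∣ᶜ c → ∀ j k → c j ≡ c k [mod ℓ ]
∣ᶜ⇒≡-mod {ℓ} {c = c} (d , m , c≡ℓd+m) j k = mod-by (divides (d j - d k) (begin
  c j - c k                              ≡⟨ cong₂ _-_ (c≡ℓd+m j) (c≡ℓd+m k) ⟩
  (+ ℓ * d j + m) - (+ ℓ * d k + m)      ≡⟨ identity (+ ℓ) (d j) (d k) m ⟩
  (d j - d k) * + ℓ                      ∎))
  where
  open ≡-Reasoning
  identity : ∀ l a b m → (l * a + m) - (l * b + m) ≡ (a - b) * l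
  identity = solve-∀

ζ^-coefficient : ∀ {p a} {P : Set a} (P? : Dec P) (j k : Fin p) →
                 (if does P? then ζ^ j else 0ᶜ) k ≡ + 𝟙 (P? ×-dec j ≟ k)
ζ^-coefficient (yes _) j k with does (j ≟ k)
... | true  = refl
... | false = refl
ζ^-coefficient (no _)  j k = refl

sumᶜ-coefficient : ∀ {p} {B : Set} (t : B → Cyc p) (f : B → ℕ) (k : Fin p) →
                   (∀ b → t b k ≡ + f b) → ∀ bs → sumᶜ (map t bs) k ≡ + sum (map f bs)
sumᶜ-coefficient t f k t≡f []       = refl
sumᶜ-coefficient t f k t≡f (b ∷ bs) =
  trans (cong₂ _+_ (t≡f b) (sumᶜ-coefficient t f k t≡f bs)) (sym (ℤP.pos-+ (f b) _))

sum-tabulate : ∀ {n} (f : Fin n → ℕ) → sum (tabulate f) ≡ ∑[ i < n ] f i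
sum-tabulate {zero}  f = refl
sum-tabulate {suc n} f = cong (f zero ℕ.+_) (sum-tabulate (f ∘ suc))

sum-map-allFin : ∀ {n} (f : Fin n → ℕ) → sum (map f (allFin n)) ≡ ∑[ i < n ] f i
sum-map-allFin f = trans (cong sum (map-tabulate id f)) (sum-tabulate f)

sum-map-concatMap : ∀ {A B : Set} (f : B → ℕ) (g : A → List B) xs →
                    sum (map f (concatMap g xs)) ≡ sum (map (λ x → sum (map f (g x))) xs)
sum-map-concatMap f g []       = refl
sum-map-concatMap f g (x ∷ xs) = begin
  sum (map f (g x ++ concatMap g xs))                   ≡⟨ cong sum (map-++ f (g x) (concatMap g xs)) ⟩
  sum (map f (g x) ++ map f (concatMap g xs))           ≡⟨ sum-++ (map f (g x)) _ ⟩
  sum (map f (g x)) ℕ.+ sum (map f (concatMap g xs))    ≡⟨ cong (sum (map f (g x)) ℕ.+_) (sum-map-concatMap f g xs) ⟩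
  sum (map f (g x)) ℕ.+ sum (map (λ x → sum (map f (g x))) xs) ∎
  where open ≡-Reasoning

sum-pairs : ∀ n (f : Fin n × Fin n → ℕ) → sum (map f (pairs n)) ≡ ∑[ x < n ] ∑[ y < n ] f (x , y)
sum-pairs n f = begin
  sum (map f (pairs n))                                          ≡⟨ sum-map-concatMap f _ (allFin n) ⟩
  sum (map (λ x → sum (map f (map (x ,_) (allFin n)))) (allFin n)) ≡⟨ cong sum (map-cong row (allFin n)) ⟩
  sum (map (λ x → ∑[ y < n ] f (x , y)) (allFin n))              ≡⟨ sum-map-allFin (λ x → ∑[ y < n ] f (x , y)) ⟩
  ∑[ x < n ] ∑[ y < n ] f (x , y)                                ∎
  where
  open ≡-Reasoning
  row : ∀ x → sum (map f (map (x ,_) (allFin n))) ≡ ∑[ y < n ] f (x , y)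
  row x = trans (cong sum (sym (map-∘ (allFin n)))) (sum-map-allFin (λ y → f (x , y)))

module Counting {n} (p-prime : Prime (suc n)) {e : Fin (suc n) → Fin (suc n)}
                (e-hom : IsAddHom (suc n) e) (e-nontrivial : Nontrivial (suc n) e) (a : ℤ) where

  private
    p = suc n
    A : Fin p
    A = [ a ]ₚ

  δ : Fin p → Fin p → Fin p → ℕ
  δ k x y = 𝟙 (x ⊗ y ≟ A ×-dec e (x ⊕ y) ≟ k)

  N : Fin p → ℕ
  N k = ∑[ x < p ] ∑[ y < p ] δ k x y

  K₂-coefficient : ∀ k → K₂ p e a k ≡ + N k
  K₂-coefficient k =
    trans (sumᶜ-coefficient (λ (x , y) → if does (x ⊗ y ≟ A) then ζ^ (e (x ⊕ y)) else 0ᶜ)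
                            (λ (x , y) → δ k x y) k
                            (λ (x , y) → ζ^-coefficient (x ⊗ y ≟ A) (e (x ⊕ y)) k) (pairs p))
          (cong +_ (sum-pairs p _))

  δ≤1 : ∀ k x y → δ k x y ≤ 1
  δ≤1 k x y = 𝟙≤1 (x ⊗ y ≟ A ×-dec e (x ⊕ y) ≟ k)

  δ≢0⇒ : ∀ k x y → δ k x y ≢ 0 → x ⊗ y ≡ A × e (x ⊕ y) ≡ k
  δ≢0⇒ k x y = 𝟙≢0⇒ (x ⊗ y ≟ A ×-dec e (x ⊕ y) ≟ k)

  δ-same-sum : ∀ k x y x′ y′ → δ k x y ≢ 0 → δ k x′ y′ ≢ 0 → x ⊕ y ≡ x′ ⊕ y′
  δ-same-sum k x y x′ y′ δ≢0 δ′≢0 = e-injective e-hom p-prime e-nontrivial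
    (trans (proj₂ (δ≢0⇒ k x y δ≢0)) (sym (proj₂ (δ≢0⇒ k x′ y′ δ′≢0))))

  δ-same-product : ∀ k x y x′ y′ → δ k x y ≢ 0 → δ k x′ y′ ≢ 0 → x ⊗ y ≡ x′ ⊗ y′
  δ-same-product k x y x′ y′ δ≢0 δ′≢0 = trans (proj₁ (δ≢0⇒ k x y δ≢0)) (sym (proj₁ (δ≢0⇒ k x′ y′ δ′≢0)))

  ∑δ≤1 : ∀ k x → ∑[ y < p ] δ k x y ≤ 1
  ∑δ≤1 k x = ∑-≤1 (δ k x) (δ≤1 k x) λ y y′ δ≢0 δ′≢0 →
    ⊕-cancelˡ x (δ-same-sum k x y x y′ δ≢0 δ′≢0)

  N≤2 : ∀ k → N k ≤ 2
  N≤2 k = ∑-≤2 (λ x → ∑[ y < p ] δ k x y) (∑δ≤1 k) λ x ∑δ≢0 →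
    let y , δ≢0 = ∑≢0⇒∃ (δ k x) ∑δ≢0 in
    y , λ x′ ∑δ′≢0 →
      let y′ , δ′≢0 = ∑≢0⇒∃ (δ k x′) ∑δ′≢0 in
      Sum.map sym sym (vieta p-prime (δ-same-sum k x y x′ y′ δ≢0 δ′≢0) (δ-same-product k x y x′ y′ δ≢0 δ′≢0))

  ∑N≡∑rows : ∑[ k < p ] N k ≡ ∑[ x < p ] ∑[ y < p ] 𝟙 (x ⊗ y ≟ A)
  ∑N≡∑rows = begin
    ∑[ k < p ] ∑[ x < p ] ∑[ y < p ] δ k x y   ≡⟨ ∑-comm (λ k x → ∑[ y < p ] δ k x y) ⟩
    ∑[ x < p ] ∑[ k < p ] ∑[ y < p ] δ k x y   ≡⟨ sum-cong-≗ (λ x → ∑-comm (λ k y → δ k x y)) ⟩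
    ∑[ x < p ] ∑[ y < p ] ∑[ k < p ] δ k x y   ≡⟨ sum-cong-≗ (λ x → sum-cong-≗ (λ y →
                                                    ∑-𝟙-× (x ⊗ y ≟ A) (e (x ⊕ y)))) ⟩
    ∑[ x < p ] ∑[ y < p ] 𝟙 (x ⊗ y ≟ A)       ∎
    where open ≡-Reasoning

  row-nonzero : ∀ {x} → toℕ x ≢ 0 → ∑[ y < p ] 𝟙 (x ⊗ y ≟ A) ≡ 1
  row-nonzero {x} x≢0 = let y₀ , xy₀≡A = ⊗-solvable p-prime x≢0 A in trans
    (sum-cong-≗ λ y → 𝟙-cong (λ xy≡A → ⊗-cancelˡ p-prime x≢0 (trans xy₀≡A (sym xy≡A)))
                             (λ { refl → xy₀≡A }) (x ⊗ y ≟ A) (y₀ ≟ y))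
    (∑-𝟙-≟ y₀)

  ∑N : ∑[ k < p ] N k ≡ p ℕ.* 𝟙 (zero ≟ A) ℕ.+ n
  ∑N = begin
    ∑[ k < p ] N k
      ≡⟨ ∑N≡∑rows ⟩
    ∑[ y < p ] 𝟙 (zero ≟ A) ℕ.+ ∑[ x < n ] ∑[ y < p ] 𝟙 (suc x ⊗ y ≟ A)
      ≡⟨ cong₂ ℕ._+_ (∑-const p (𝟙 (zero ≟ A))) (sum-cong-≗ λ x → row-nonzero {suc x} λ ()) ⟩
    p ℕ.* 𝟙 (zero ≟ A) ℕ.+ ∑[ x < n ] 1
      ≡⟨ cong (p ℕ.* 𝟙 (zero ≟ A) ℕ.+_) (trans (∑-const n 1) (ℕP.*-identityʳ n)) ⟩
    p ℕ.* 𝟙 (zero ≟ A) ℕ.+ n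
      ∎
    where open ≡-Reasoning

lemma2p4 : (ℓ p : ℕ) .{{_ : NonZero p}} → Prime ℓ → Prime p → ℓ ≢ 2 → ℓ ≢ p →
    (a : ℤ) (e : Fin p → Fin p) → IsAddHom p e → Nontrivial p e →
    ¬ (ℓ ∣ᶜ K₂ p e a)
lemma2p4 ℓ zero {{()}}
lemma2p4 ℓ (suc n) ℓ-prime p-prime ℓ≢2 _ a e e-hom e-nontrivial ℓ∣K₂ =
  n≢0 (∣∧<⇒≡0 p∣n (ℕP.n<1+n n))
  where
  open Counting p-prime e-hom e-nontrivial a

  n≢0 : n ≢ 0
  n≢0 = ℕP.m<n⇒n≢0 (ℕ.s<s⁻¹ (ℕ.nonTrivial⇒n>1 (suc n) {{prime⇒nonTrivial p-prime}}))

  N<ℓ : ∀ k → N k < ℓ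
  N<ℓ k = ℕP.≤-<-trans (N≤2 k) (ℕP.≤∧≢⇒< (ℕ.nonTrivial⇒n>1 ℓ {{prime⇒nonTrivial ℓ-prime}}) (ℓ≢2 ∘ sym))

  N-constant : ∀ k → N k ≡ N zero
  N-constant k = mod-injective-<
    (subst₂ _≡_[mod ℓ ] (K₂-coefficient k) (K₂-coefficient zero) (∣ᶜ⇒≡-mod ℓ∣K₂ k zero))
    (N<ℓ k) (N<ℓ zero)

  p*N₀≡p*𝟙+n : suc n ℕ.* N zero ≡ suc n ℕ.* 𝟙 (zero ≟ [ a ]ₚ) ℕ.+ n
  p*N₀≡p*𝟙+n = trans (sym (trans (sum-cong-≗ N-constant) (∑-const (suc n) (N zero)))) ∑N

  p∣n : suc n ℕD.∣ n
  p∣n = ℕD.∣m+n∣m⇒∣n (subst (suc n ℕD.∣_) p*N₀≡p*𝟙+n (ℕD.m∣m*n (N zero))) (ℕD.m∣m*n _)
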